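{- Let $T\subseteq S$ and let $G=A_m$, $m\ge1$, be an alternating group. If there exists $n_0\in\mathbb{N}$ such that $\langle S_n(T)\rangle\cong G$ for every $n\ge n_0$, then $m\le 2$.
   Context: $S_n$ is the symmetric group on $[n]$, $S=\bigcup_{n\ge0}S_n$, and $A_m$ is the alternating group of even permutations of $[m]$. A permutation $\pi\in S_n$ contains the pattern $\tau\in S_k$ if some subsequence of $\pi$ of length $k$ is order-isomorphic to $\tau$; otherwise it avoids $\tau$. For $T\subseteq S$, $S_n(T)$ is the set of permutations in $S_n$ avoiding every pattern in $T$, and $\langle S_n(T)\rangle$ is the subgroup of $S_n$ it generates. -}

module Defs where

open import Level using (0ℓ)
open import Data.Nat using (ℕ; zero; suc)
open import Data.Nat.Properties using () renaming (_≟_ to _≟ℕ_)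
open import Data.Fin using (Fin; _<_; _<?_)
open import Data.Fin.Permutation
  using (Permutation′; _⟨$⟩ʳ_; _≈_; id; flip; _∘ₚ_)
open import Data.List using (List; length; filter; cartesianProduct)
open import Data.List.Base using (allFin)
open import Data.Product using (Σ; _×_; _,_; proj₁; proj₂; ∃)
open import Relation.Nullary using (¬_; _×-dec_)
open import Function.Bundles using (_⇔_)
open import Data.Nat.Base using (_%_)
open import Relation.Binary.PropositionalEquality using (_≡_)

Perm : ℕ → Set
Perm n = Permutation′ n

PatternSet : Set₁
PatternSet = (k : ℕ) → Perm k → Set

Contains : {n k : ℕ} → Perm n → Perm k → Set
Contains {n} {k} π τ =
  Σ (Fin k → Fin n) λ f →
    ((i j : Fin k) → i < j → f i < f j) ×
    ((i j : Fin k) → (τ ⟨$⟩ʳ i < τ ⟨$⟩ʳ j) ⇔ (π ⟨$⟩ʳ f i < π ⟨$⟩ʳ f j))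

Avoids : {n k : ℕ} → Perm n → Perm k → Set
Avoids π τ = ¬ Contains π τ

AvoidsAll : PatternSet → {n : ℕ} → Perm n → Set
AvoidsAll T π = ∀ k (τ : Perm k) → T k τ → Avoids π τ

data InGen {n : ℕ} (X : Perm n → Set) : Perm n → Set where
  gen  : ∀ {σ} → X σ → InGen X σ
  one  : InGen X id
  mul  : ∀ {σ τ} → InGen X σ → InGen X τ → InGen X (σ ∘ₚ τ)
  inv  : ∀ {σ} → InGen X σ → InGen X (flip σ)
  resp : ∀ {σ τ} → σ ≈ τ → InGen X σ → InGen X τ

GenAvoid : PatternSet → (n : ℕ) → Perm n → Set
GenAvoid T n = InGen (AvoidsAll T)

inversions : {m : ℕ} → Perm m → ℕ
inversions {m} σ =
  length (filter (λ p → (proj₁ p <? proj₂ p) ×-dec (σ ⟨$⟩ʳ proj₂ p <? σ ⟨$⟩ʳ proj₁ p))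
                 (cartesianProduct (allFin m) (allFin m)))

Even : {m : ℕ} → Perm m → Set
Even σ = inversions σ % 2 ≡ 0

record SubgroupIso {n m : ℕ} (H : Perm n → Set) (K : Perm m → Set) : Set where
  field
    to       : Σ (Perm n) H → Σ (Perm m) K
    from     : Σ (Perm m) K → Σ (Perm n) H
    to-cong  : ∀ x y → proj₁ x ≈ proj₁ y → proj₁ (to x) ≈ proj₁ (to y)
    from-cong : ∀ x y → proj₁ x ≈ proj₁ y → proj₁ (from x) ≈ proj₁ (from y)
    to-from  : ∀ y → proj₁ (to (from y)) ≈ proj₁ y
    from-to  : ∀ x → proj₁ (from (to x)) ≈ proj₁ x
    to-hom   : ∀ x y (hxy : H (proj₁ x ∘ₚ proj₁ y)) →
               proj₁ (to (proj₁ x ∘ₚ proj₁ y , hxy)) ≈ (proj₁ (to x) ∘ₚ proj₁ (to y))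

GenIsoAlt : PatternSet → (n m : ℕ) → Set
GenIsoAlt T n m = SubgroupIso (GenAvoid T n) (Even {m})

{-# OPTIONS --safe #-}
module Submission where

-- Transporting the sign along ⟨Sₙ(T)⟩ ≅ Aₘ gives a homomorphism Aₘ → ℤ/2. It is trivial:
-- Aₘ is generated by products of two adjacent transpositions, each such product telescopes
-- into products (i i+1)(i+1 i+2), and these are 3-cycles, so they map to 0. Hence every
-- T-avoider of length at least n₀ is even. Deleting an entry x changes the number of
-- inversions by the number of inversions involving x; so if some T-avoider of length
-- n₀ + 2 had an inversion (p, q), then deleting q, or p and then q, would yield an odd
-- T-avoider of length at least n₀. Therefore S_{n₀+2}(T) = {id}, and ⟨S_{n₀+2}(T)⟩ ≅ Aₘ
-- forces m ≤ 2.

open import Defs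
open import Data.Nat as ℕ using (ℕ; zero; suc; _+_; _≤_; z≤n; s≤s; _%_; parity)
import Data.Nat.Induction as ℕ
import Data.Nat.Properties as ℕ
open import Level using (Level)
open import Algebra.Properties.CommutativeSemigroup ℕ.+-commutativeSemigroup
  using () renaming (interchange to +-interchange)
open import Algebra.Properties.CommutativeMonoid.Sum ℕ.+-0-commutativeMonoid
  using (sum-syntax; sum-cong-≗; sum-remove; sum-permute; ∑-distrib-+; sum-replicate-zero)
open import Data.Bool using (if_then_else_)
open import Data.Fin as Fin using (Fin; zero; suc; toℕ; _<_; _<?_; _≟_; inject₁; punchIn; punchOut)
import Data.Fin.Properties as Fin
open import Data.Fin.Permutation
  using (_⟨$⟩ʳ_; _⟨$⟩ˡ_; _≈_; id; flip; _∘ₚ_; transpose; remove; inverseˡ; inverseʳ; punchIn-permute)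
open import Data.List using (List; _++_; length; filter; map; tabulate; cartesianProduct)
open import Data.List.Properties using (length-++; filter-++; map-tabulate)
open import Data.Parity.Base as ℙ using (Parity; 0ℙ; 1ℙ; _⁻¹)
import Data.Parity.Properties as ℙ
open import Data.Product using (Σ; ∃; _×_; _,_; proj₁; proj₂)
open import Data.Product.Function.NonDependent.Propositional using (_×-⇔_)
open import Data.Sum using (_⊎_; inj₁; inj₂)
open import Function as Fun using (_∘_; _⇔_; mk⇔; Equivalence)
open import Function.Construct.Composition using (_⇔-∘_)
open import Function.Construct.Identity using (⇔-id)
open import Function.Construct.Symmetry using (⇔-sym)
open import Induction.WellFounded using (Acc; acc)
open import Relation.Binary using (_Preserves_⟶_; tri<; tri≈; tri>)
open import Relation.Binary.PropositionalEquality
open import Relation.Nullary using (Dec; does; yes; no; ¬_; _×-dec_)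
open import Relation.Nullary.Decidable using (dec-true; dec-false)
open import Relation.Nullary.Negation using (contradiction)
open import Relation.Unary using (Pred; Decidable)

private
  variable
    a : Level
    A B : Set a
    n : ℕ

-- Counting with indicator functions

𝟙 : Dec A → ℕ
𝟙 d = if does d then 1 else 0

𝟙-yes : (d : Dec A) → A → 𝟙 d ≡ 1
𝟙-yes (yes _) _ = refl
𝟙-yes (no ¬a) a = contradiction a ¬a

𝟙-no : (d : Dec A) → ¬ A → 𝟙 d ≡ 0
𝟙-no (yes a) ¬a = contradiction a ¬a
𝟙-no (no _)  _  = refl

𝟙-cong : (d : Dec A) (e : Dec B) → A ⇔ B → 𝟙 d ≡ 𝟙 e
𝟙-cong (yes _) (yes _) _   = refl
𝟙-cong (yes a) (no ¬b) A⇔B = contradiction (Equivalence.to A⇔B a) ¬b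
𝟙-cong (no ¬a) (yes b) A⇔B = contradiction (Equivalence.from A⇔B b) ¬a
𝟙-cong (no _)  (no _)  _   = refl

module _ {P : Pred A a} (P? : Decidable P) where

  length-filter-tabulate : (g : Fin n → A) → length (filter P? (tabulate g)) ≡ ∑[ i < n ] 𝟙 (P? (g i))
  length-filter-tabulate {zero}  g = refl
  length-filter-tabulate {suc n} g with P? (g zero)
  ... | yes _ = cong suc (length-filter-tabulate (g ∘ suc))
  ... | no _  = length-filter-tabulate (g ∘ suc)

  length-filter-++ : (xs ys : List A) →
    length (filter P? (xs ++ ys)) ≡ length (filter P? xs) + length (filter P? ys)
  length-filter-++ xs ys = trans (cong length (filter-++ P? xs ys)) (length-++ (filter P? xs))

length-filter-cartesianProduct : ∀ {m k} {P : Pred (A × B) a} (P? : Decidable P)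
  (g : Fin m → A) (h : Fin k → B) →
  length (filter P? (cartesianProduct (tabulate g) (tabulate h))) ≡ ∑[ i < m ] ∑[ j < k ] 𝟙 (P? (g i , h j))
length-filter-cartesianProduct {m = zero}  P? g h = refl
length-filter-cartesianProduct {m = suc m} P? g h =
  trans (length-filter-++ P? (map (g zero ,_) (tabulate h)) _)
        (cong₂ _+_ first-row (length-filter-cartesianProduct P? (g ∘ suc) h))
  where
  first-row : length (filter P? (map (g zero ,_) (tabulate h))) ≡ ∑[ j < _ ] 𝟙 (P? (g zero , h j))
  first-row = trans (cong (length ∘ filter P?) (map-tabulate h (g zero ,_)))
                    (length-filter-tabulate P? (λ j → g zero , h j))

∑-zero : (f : Fin n → ℕ) → (∀ i → f i ≡ 0) → ∑[ i < n ] f i ≡ 0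
∑-zero {n} f f≗0 = trans (sum-cong-≗ f≗0) (sum-replicate-zero n)

∑∑-distrib-+ : (f g : Fin n → Fin n → ℕ) →
  ∑[ i < n ] ∑[ j < n ] (f i j + g i j) ≡ ∑[ i < n ] ∑[ j < n ] f i j + ∑[ i < n ] ∑[ j < n ] g i j
∑∑-distrib-+ {n} f g =
  trans (sum-cong-≗ λ i → ∑-distrib-+ (f i) (g i)) (∑-distrib-+ {n} (λ i → ∑[ j < n ] f i j) _)

-- The sign of a permutation

inversionAt : Perm n → Fin n → Fin n → ℕ
inversionAt σ i j = 𝟙 ((i <? j) ×-dec (σ ⟨$⟩ʳ j <? σ ⟨$⟩ʳ i))

#inversions : Perm n → ℕ
#inversions {n} σ = ∑[ i < n ] ∑[ j < n ] inversionAt σ i j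

inversions≡#inversions : (σ : Perm n) → inversions σ ≡ #inversions σ
inversions≡#inversions {n} σ = length-filter-cartesianProduct {m = n} {k = n} _ Fun.id Fun.id

#inversions-cong : {σ τ : Perm n} → σ ≈ τ → #inversions σ ≡ #inversions τ
#inversions-cong σ≈τ = sum-cong-≗ λ i → sum-cong-≗ λ j →
  cong₂ (λ x y → 𝟙 ((i <? j) ×-dec (x <? y))) (σ≈τ j) (σ≈τ i)

#inversions-id : #inversions (id {n}) ≡ 0
#inversions-id {n} = ∑-zero {n} _ λ i → ∑-zero {n} _ λ j →
  𝟙-no ((i <? j) ×-dec (j <? i)) λ (i<j , j<i) → Fin.<-asym i<j j<i

parity-suc : ∀ k → parity (suc k) ≡ parity k ⁻¹
parity-suc k = sym (ℙ.⁻¹-selfInverse (ℙ.suc-homo-⁻¹ k))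

⁻¹-+ : ∀ x y → (x ℙ.+ y) ⁻¹ ≡ x ⁻¹ ℙ.+ y
⁻¹-+ 0ℙ y = refl
⁻¹-+ 1ℙ y = ℙ.⁻¹-involutive y

sign : Perm n → Parity
sign σ = parity (#inversions σ)

sign-cong : {σ τ : Perm n} → σ ≈ τ → sign σ ≡ sign τ
sign-cong {σ = σ} {τ} σ≈τ = cong parity (#inversions-cong {σ = σ} {τ} σ≈τ)

sign-id : sign (id {n}) ≡ 0ℙ
sign-id {n} = cong parity (#inversions-id {n})

%2≡0⇒parity≡0ℙ : ∀ k → k % 2 ≡ 0 → parity k ≡ 0ℙ
%2≡0⇒parity≡0ℙ zero          _ = refl
%2≡0⇒parity≡0ℙ (suc (suc k)) h = %2≡0⇒parity≡0ℙ k h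

parity≡0ℙ⇒%2≡0 : ∀ k → parity k ≡ 0ℙ → k % 2 ≡ 0
parity≡0ℙ⇒%2≡0 zero          _ = refl
parity≡0ℙ⇒%2≡0 (suc (suc k)) h = parity≡0ℙ⇒%2≡0 k h

even⇒sign≡0ℙ : (σ : Perm n) → Even σ → sign σ ≡ 0ℙ
even⇒sign≡0ℙ σ =
  %2≡0⇒parity≡0ℙ (#inversions σ) ∘ subst (λ k → k % 2 ≡ 0) (inversions≡#inversions σ)

sign≡0ℙ⇒even : (σ : Perm n) → sign σ ≡ 0ℙ → Even σ
sign≡0ℙ⇒even σ =
  subst (λ k → k % 2 ≡ 0) (sym (inversions≡#inversions σ)) ∘ parity≡0ℙ⇒%2≡0 (#inversions σ)

-- Adjacent transpositions

<-irrefl-⇔ : (i j : Fin n) → i < i ⇔ j < j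
<-irrefl-⇔ i j = mk⇔ (λ i<i → contradiction i<i (Fin.<-irrefl refl))
                     (λ j<j → contradiction j<j (Fin.<-irrefl refl))

⟨$⟩ʳ-injective : (σ : Perm n) {i j : Fin n} → σ ⟨$⟩ʳ i ≡ σ ⟨$⟩ʳ j → i ≡ j
⟨$⟩ʳ-injective σ σi≡σj = trans (sym (inverseˡ σ)) (trans (cong (σ ⟨$⟩ˡ_) σi≡σj) (inverseˡ σ))

data Position (i j : Fin n) : Fin n → Set where
  at-left   : Position i j i
  at-right  : Position i j j
  elsewhere : ∀ {k} → k ≢ i → k ≢ j → Position i j k

position : (i j k : Fin n) → Position i j k
position i j k with k ≟ i | k ≟ j
... | yes refl | _        = at-left
... | no _     | yes refl = at-right
... | no k≢i   | no k≢j   = elsewhere k≢i k≢j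

module _ (i j : Fin n) where

  transpose-matchˡ : transpose i j ⟨$⟩ʳ i ≡ j
  transpose-matchˡ rewrite dec-true (i ≟ i) refl = refl

  transpose-matchʳ : transpose i j ⟨$⟩ʳ j ≡ i
  transpose-matchʳ with j ≟ i
  ... | yes j≡i = j≡i
  ... | no _ rewrite dec-true (j ≟ j) refl = refl

  transpose-mismatch : ∀ {k} → k ≢ i → k ≢ j → transpose i j ⟨$⟩ʳ k ≡ k
  transpose-mismatch {k} k≢i k≢j rewrite dec-false (k ≟ i) k≢i | dec-false (k ≟ j) k≢j = refl

  transpose-involutive : transpose i j ∘ₚ transpose i j ≈ id
  transpose-involutive k with position i j k
  ... | at-left           = trans (cong (transpose i j ⟨$⟩ʳ_) transpose-matchˡ) transpose-matchʳ
  ... | at-right          = trans (cong (transpose i j ⟨$⟩ʳ_) transpose-matchʳ) transpose-matchˡ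
  ... | elsewhere k≢i k≢j =
    trans (cong (transpose i j ⟨$⟩ʳ_) (transpose-mismatch k≢i k≢j)) (transpose-mismatch k≢i k≢j)

Adjacent : Fin n → Fin n → Set
Adjacent i j = toℕ j ≡ suc (toℕ i)

adjacent⇒< : ∀ {i j : Fin n} → Adjacent i j → i < j
adjacent⇒< adj = ℕ.≤-reflexive (sym adj)

module _ {p q : Fin n} (adj : Adjacent p q) {k : Fin n} (k≢p : k ≢ p) (k≢q : k ≢ q) where

  <-adjacent⇔ : k < p ⇔ k < q
  <-adjacent⇔ = mk⇔ (λ k<p → ℕ.<-trans k<p (adjacent⇒< adj))
                    (λ k<q → Fin.≤∧≢⇒< (ℕ.s≤s⁻¹ (subst (toℕ k ℕ.<_) adj k<q)) k≢p)

  adjacent-<⇔ : p < k ⇔ q < k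
  adjacent-<⇔ = mk⇔ (λ p<k → Fin.≤∧≢⇒< (subst (ℕ._≤ toℕ k) (sym adj) p<k) (k≢q ∘ sym))
                    (λ q<k → ℕ.<-trans (adjacent⇒< adj) q<k)

∑-𝟙≟ : (p : Fin n) → ∑[ i < n ] 𝟙 (i ≟ p) ≡ 1
∑-𝟙≟ {suc n} p = trans (sum-remove {i = p} (λ i → 𝟙 (i ≟ p)))
  (cong₂ _+_ (𝟙-yes (p ≟ p) refl) (∑-zero {n} _ λ j → 𝟙-no (punchIn p j ≟ p) (Fin.punchInᵢ≢i p j)))

∑∑-𝟙≟ : (p q : Fin n) → ∑[ i < n ] ∑[ j < n ] 𝟙 ((i ≟ p) ×-dec (j ≟ q)) ≡ 1
∑∑-𝟙≟ {n} p q = trans (sum-cong-≗ row) (∑-𝟙≟ p)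
  where
  row : ∀ i → ∑[ j < n ] 𝟙 ((i ≟ p) ×-dec (j ≟ q)) ≡ 𝟙 (i ≟ p)
  row i with i ≟ p
  ... | yes _ = ∑-𝟙≟ q
  ... | no _  = ∑-zero {n} _ λ _ → refl

-- ∘ₚ composes left to right, so transpose p q ∘ₚ σ is σ with the entries at positions p and q swapped.
#inversions-transpose∘ : (p q : Fin n) (σ : Perm n) → let s = transpose p q ⟨$⟩ʳ_ in
  #inversions (transpose p q ∘ₚ σ) ≡
  ∑[ a < n ] ∑[ b < n ] 𝟙 ((s a <? s b) ×-dec (σ ⟨$⟩ʳ b <? σ ⟨$⟩ʳ a))
#inversions-transpose∘ p q σ =
  trans (sum-permute _ (transpose p q)) (sum-cong-≗ λ a →
  trans (sum-permute _ (transpose p q)) (sum-cong-≗ λ b →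
  cong₂ (λ x y → 𝟙 ((s a <? s b) ×-dec (σ ⟨$⟩ʳ x <? σ ⟨$⟩ʳ y)))
        (transpose-involutive p q b) (transpose-involutive p q a)))
  where s = transpose p q ⟨$⟩ʳ_

module _ {p q : Fin n} (adj : Adjacent p q) where

  private
    s = transpose p q ⟨$⟩ʳ_

  transpose-adjacent-preserves-< : ∀ {a b} → ¬ (a ≡ p × b ≡ q) → ¬ (a ≡ q × b ≡ p) →
                                   (s a < s b) ⇔ (a < b)
  transpose-adjacent-preserves-< {a} {b} ¬pq ¬qp with position p q a | position p q b
  ... | at-left  | at-left  = <-irrefl-⇔ _ _
  ... | at-left  | at-right = contradiction (refl , refl) ¬pq
  ... | at-right | at-left  = contradiction (refl , refl) ¬qp
  ... | at-right | at-right = <-irrefl-⇔ _ _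
  ... | at-left  | elsewhere b≢p b≢q
    rewrite transpose-matchˡ p q | transpose-mismatch p q b≢p b≢q = ⇔-sym (adjacent-<⇔ adj b≢p b≢q)
  ... | at-right | elsewhere b≢p b≢q
    rewrite transpose-matchʳ p q | transpose-mismatch p q b≢p b≢q = adjacent-<⇔ adj b≢p b≢q
  ... | elsewhere a≢p a≢q | at-left
    rewrite transpose-matchˡ p q | transpose-mismatch p q a≢p a≢q = ⇔-sym (<-adjacent⇔ adj a≢p a≢q)
  ... | elsewhere a≢p a≢q | at-right
    rewrite transpose-matchʳ p q | transpose-mismatch p q a≢p a≢q = <-adjacent⇔ adj a≢p a≢q
  ... | elsewhere a≢p a≢q | elsewhere b≢p b≢q
    rewrite transpose-mismatch p q a≢p a≢q | transpose-mismatch p q b≢p b≢q = ⇔-id _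

  module _ (σ : Perm n) (descent : σ ⟨$⟩ʳ q < σ ⟨$⟩ʳ p) where

    private
      p<q = adjacent⇒< adj

      σ-descent? : (a b : Fin n) → Dec (σ ⟨$⟩ʳ b < σ ⟨$⟩ʳ a)
      σ-descent? a b = σ ⟨$⟩ʳ b <? σ ⟨$⟩ʳ a

      isPair : Fin n → Fin n → ℕ
      isPair a b = 𝟙 ((a ≟ p) ×-dec (b ≟ q))

      swapped : Fin n → Fin n → ℕ
      swapped a b = 𝟙 ((s a <? s b) ×-dec σ-descent? a b)

    -- (p, q) is the only pair whose inversion status the swap changes.
    inversionAt-transpose : ∀ a b → isPair a b + swapped a b ≡ inversionAt σ a b
    inversionAt-transpose a b with (a ≟ p) ×-dec (b ≟ q) | (a ≟ q) ×-dec (b ≟ p)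
    ... | yes (refl , refl) | _ = trans
      (cong₂ _+_ (𝟙-yes ((p ≟ p) ×-dec (q ≟ q)) (refl , refl))
                 (𝟙-no ((s p <? s q) ×-dec σ-descent? p q) λ (sp<sq , _) →
                    Fin.<-asym p<q (subst₂ _<_ (transpose-matchˡ p q) (transpose-matchʳ p q) sp<sq)))
      (sym (𝟙-yes ((p <? q) ×-dec σ-descent? p q) (p<q , descent)))
    ... | no ¬pq | yes (refl , refl) = trans
      (cong₂ _+_ (𝟙-no ((q ≟ p) ×-dec (p ≟ q)) ¬pq)
                 (𝟙-no ((s q <? s p) ×-dec σ-descent? q p) λ (_ , σp<σq) → Fin.<-asym descent σp<σq))
      (sym (𝟙-no ((q <? p) ×-dec σ-descent? q p) λ (q<p , _) → Fin.<-asym p<q q<p))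
    ... | no ¬pq | no ¬qp = cong₂ _+_
      (𝟙-no ((a ≟ p) ×-dec (b ≟ q)) ¬pq)
      (𝟙-cong ((s a <? s b) ×-dec σ-descent? a b) ((a <? b) ×-dec σ-descent? a b)
              (transpose-adjacent-preserves-< ¬pq ¬qp ×-⇔ ⇔-id _))

    #inversions-transpose-descent : suc (#inversions (transpose p q ∘ₚ σ)) ≡ #inversions σ
    #inversions-transpose-descent = begin
      suc (#inversions (transpose p q ∘ₚ σ))
        ≡⟨ cong₂ _+_ (sym (∑∑-𝟙≟ p q)) (#inversions-transpose∘ p q σ) ⟩
      ∑[ a < n ] ∑[ b < n ] isPair a b + ∑[ a < n ] ∑[ b < n ] swapped a b
        ≡⟨ ∑∑-distrib-+ isPair swapped ⟨
      ∑[ a < n ] ∑[ b < n ] (isPair a b + swapped a b)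
        ≡⟨ sum-cong-≗ (λ a → sum-cong-≗ (inversionAt-transpose a)) ⟩
      #inversions σ ∎
      where open ≡-Reasoning

  sign-transpose∘ : (σ : Perm n) → sign (transpose p q ∘ₚ σ) ≡ sign σ ⁻¹
  sign-transpose∘ σ with σ ⟨$⟩ʳ q <? σ ⟨$⟩ʳ p
  ... | yes descent = begin
    parity (#inversions (t ∘ₚ σ))             ≡⟨ ℙ.suc-homo-⁻¹ (#inversions (t ∘ₚ σ)) ⟨
    parity (suc (#inversions (t ∘ₚ σ))) ⁻¹    ≡⟨ cong (λ k → parity k ⁻¹) (#inversions-transpose-descent σ descent) ⟩
    sign σ ⁻¹                                ∎
    where
    open ≡-Reasoning
    t = transpose p q
  ... | no ¬descent = begin
    parity (#inversions (t ∘ₚ σ))             ≡⟨ cong parity (#inversions-transpose-descent (t ∘ₚ σ) descent) ⟨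
    parity (suc (#inversions (t ∘ₚ t ∘ₚ σ)))  ≡⟨ parity-suc (#inversions (t ∘ₚ t ∘ₚ σ)) ⟩
    sign (t ∘ₚ t ∘ₚ σ) ⁻¹                    ≡⟨ cong _⁻¹ (sign-cong {σ = t ∘ₚ t ∘ₚ σ} {σ} t∘t∘σ≈σ) ⟩
    sign σ ⁻¹                                ∎
    where
    open ≡-Reasoning
    t = transpose p q
    t∘t∘σ≈σ : t ∘ₚ t ∘ₚ σ ≈ σ
    t∘t∘σ≈σ = cong (σ ⟨$⟩ʳ_) ∘ transpose-involutive p q
    descent : (t ∘ₚ σ) ⟨$⟩ʳ q < (t ∘ₚ σ) ⟨$⟩ʳ p
    descent = subst₂ _<_
      (cong (σ ⟨$⟩ʳ_) (sym (transpose-matchʳ p q))) (cong (σ ⟨$⟩ʳ_) (sym (transpose-matchˡ p q)))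
      (Fin.≤∧≢⇒< (ℕ.≮⇒≥ ¬descent) (Fin.<⇒≢ (adjacent⇒< adj) ∘ ⟨$⟩ʳ-injective σ))

  sign-transpose : sign (transpose p q) ≡ 1ℙ
  sign-transpose = trans (sign-cong {σ = transpose p q} {transpose p q ∘ₚ id} λ _ → refl)
                         (trans (sign-transpose∘ id) (cong _⁻¹ (sign-id {n})))

-- Induction along adjacent descents

adjacent-<⇒increasing : ∀ {m} (f : Fin n → Fin m) →
  (∀ {i j} → Adjacent i j → f i < f j) → f Preserves _<_ ⟶ _<_
adjacent-<⇒increasing f asc {zero}  {suc zero}    _ = asc refl
adjacent-<⇒increasing f asc {zero}  {suc (suc j)} _ =
  Fin.<-trans (asc refl) (adjacent-<⇒increasing (f ∘ suc) (asc ∘ cong suc) {zero} {suc j} (s≤s z≤n))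
adjacent-<⇒increasing f asc {suc i} {suc j} (s≤s i<j) = adjacent-<⇒increasing (f ∘ suc) (asc ∘ cong suc) i<j

increasing⇒≤ : ∀ {m} {f : Fin n → Fin m} → f Preserves _<_ ⟶ _<_ → ∀ i → toℕ i ℕ.≤ toℕ (f i)
increasing⇒≤     inc zero    = z≤n
increasing⇒≤ {f = f} inc (suc i) =
  ℕ.≤-<-trans (increasing⇒≤ {f = f ∘ inject₁} (inc ∘ inject₁-mono) i)
              (inc (Fin.≤̄⇒inject₁< ℕ.≤-refl))
  where
  inject₁-mono : ∀ {i j : Fin _} → i < j → inject₁ i < inject₁ j
  inject₁-mono {i} {j} = subst₂ ℕ._<_ (sym (Fin.toℕ-inject₁ i)) (sym (Fin.toℕ-inject₁ j))

increasing⇒inverse-increasing : (σ : Perm n) →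
  (σ ⟨$⟩ʳ_) Preserves _<_ ⟶ _<_ → (σ ⟨$⟩ˡ_) Preserves _<_ ⟶ _<_
increasing⇒inverse-increasing σ inc {i} {j} i<j with Fin.<-cmp (σ ⟨$⟩ˡ i) (σ ⟨$⟩ˡ j)
... | tri< σ⁻¹i<σ⁻¹j _ _ = σ⁻¹i<σ⁻¹j
... | tri≈ _ σ⁻¹i≡σ⁻¹j _ = contradiction (⟨$⟩ˡ-injective σ⁻¹i≡σ⁻¹j) (Fin.<⇒≢ i<j)
  where ⟨$⟩ˡ-injective = ⟨$⟩ʳ-injective (flip σ)
... | tri> _ _ σ⁻¹j<σ⁻¹i =
  contradiction (subst₂ _<_ (inverseʳ σ) (inverseʳ σ) (inc σ⁻¹j<σ⁻¹i)) (Fin.<-asym i<j)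

increasing⇒≈id : (σ : Perm n) → (σ ⟨$⟩ʳ_) Preserves _<_ ⟶ _<_ → σ ≈ id
increasing⇒≈id σ inc i = Fin.toℕ-injective (ℕ.≤-antisym
  (subst (λ k → toℕ (σ ⟨$⟩ʳ i) ℕ.≤ toℕ k) (inverseˡ σ)
         (increasing⇒≤ (increasing⇒inverse-increasing σ inc) (σ ⟨$⟩ʳ i)))
  (increasing⇒≤ inc i))

AdjacentDescent : Perm n → Set
AdjacentDescent {n} σ = Σ (Fin n) λ p → Σ (Fin n) λ q → Adjacent p q × σ ⟨$⟩ʳ q < σ ⟨$⟩ʳ p

adjacentDescent⊎≈id : (σ : Perm n) → AdjacentDescent σ ⊎ σ ≈ id
adjacentDescent⊎≈id σ
  with Fin.any? (λ p → Fin.any? λ q → (toℕ q ℕ.≟ suc (toℕ p)) ×-dec (σ ⟨$⟩ʳ q <? σ ⟨$⟩ʳ p))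
... | yes descent = inj₁ descent
... | no ∄descent = inj₂ (increasing⇒≈id σ (adjacent-<⇒increasing (σ ⟨$⟩ʳ_) ascent))
  where
  ascent : ∀ {p q} → Adjacent p q → σ ⟨$⟩ʳ p < σ ⟨$⟩ʳ q
  ascent adj = Fin.≤∧≢⇒< (ℕ.≮⇒≥ λ descent → ∄descent (_ , _ , adj , descent))
                         (Fin.<⇒≢ (adjacent⇒< adj) ∘ ⟨$⟩ʳ-injective σ)

module _ {ℓ} (P : Perm n → Set ℓ)
         (base : ∀ σ → σ ≈ id → P σ)
         (step : ∀ σ {p q} → Adjacent p q → σ ⟨$⟩ʳ q < σ ⟨$⟩ʳ p → P (transpose p q ∘ₚ σ) → P σ)
         where

  adjacentDescent-induction : ∀ σ → P σ
  adjacentDescent-induction σ = go σ (ℕ.<-wellFounded (#inversions σ))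
    where
    go : ∀ σ → Acc ℕ._<_ (#inversions σ) → P σ
    go σ (acc smaller) with adjacentDescent⊎≈id σ
    ... | inj₂ σ≈id = base σ σ≈id
    ... | inj₁ (p , q , adj , descent) = step σ adj descent (go (transpose p q ∘ₚ σ)
          (smaller (ℕ.≤-reflexive (#inversions-transpose-descent adj σ descent))))

sign-∘ : (σ τ : Perm n) → sign (σ ∘ₚ τ) ≡ sign σ ℙ.+ sign τ
sign-∘ {n} = adjacentDescent-induction (λ σ → ∀ τ → sign (σ ∘ₚ τ) ≡ sign σ ℙ.+ sign τ) base step
  where
  base : ∀ (σ : Perm n) → σ ≈ id → ∀ τ → sign (σ ∘ₚ τ) ≡ sign σ ℙ.+ sign τ
  base σ σ≈id τ = trans (sign-cong {σ = σ ∘ₚ τ} {τ} (cong (τ ⟨$⟩ʳ_) ∘ σ≈id))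
                        (cong (ℙ._+ sign τ) (sym (trans (sign-cong {σ = σ} {id} σ≈id) (sign-id {n}))))
  step : ∀ (σ : Perm n) {p q} → Adjacent p q → σ ⟨$⟩ʳ q < σ ⟨$⟩ʳ p →
         (∀ τ → sign ((transpose p q ∘ₚ σ) ∘ₚ τ) ≡ sign (transpose p q ∘ₚ σ) ℙ.+ sign τ) →
         ∀ τ → sign (σ ∘ₚ τ) ≡ sign σ ℙ.+ sign τ
  step σ {p} {q} adj _ ih τ = begin
    sign (σ ∘ₚ τ)                 ≡⟨ sign-cong {σ = σ ∘ₚ τ} {t ∘ₚ t ∘ₚ σ ∘ₚ τ} σ∘τ≈t∘t∘σ∘τ ⟩
    sign (t ∘ₚ (t ∘ₚ σ) ∘ₚ τ)     ≡⟨ sign-transpose∘ adj ((t ∘ₚ σ) ∘ₚ τ) ⟩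
    sign ((t ∘ₚ σ) ∘ₚ τ) ⁻¹       ≡⟨ cong _⁻¹ (ih τ) ⟩
    (sign (t ∘ₚ σ) ℙ.+ sign τ) ⁻¹ ≡⟨ ⁻¹-+ (sign (t ∘ₚ σ)) (sign τ) ⟩
    sign (t ∘ₚ σ) ⁻¹ ℙ.+ sign τ   ≡⟨ cong (λ x → x ⁻¹ ℙ.+ sign τ) (sign-transpose∘ adj σ) ⟩
    sign σ ⁻¹ ⁻¹ ℙ.+ sign τ       ≡⟨ cong (ℙ._+ sign τ) (ℙ.⁻¹-involutive (sign σ)) ⟩
    sign σ ℙ.+ sign τ             ∎
    where
    open ≡-Reasoning
    t = transpose p q
    σ∘τ≈t∘t∘σ∘τ : σ ∘ₚ τ ≈ t ∘ₚ t ∘ₚ σ ∘ₚ τ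
    σ∘τ≈t∘t∘σ∘τ = cong ((σ ∘ₚ τ) ⟨$⟩ʳ_) ∘ sym ∘ transpose-involutive p q

-- Homomorphisms from an alternating group to ℤ/2

even-resp-≈ : {σ τ : Perm n} → σ ≈ τ → Even σ → Even τ
even-resp-≈ {σ = σ} {τ} σ≈τ e =
  sign≡0ℙ⇒even τ (trans (sym (sign-cong {σ = σ} {τ} σ≈τ)) (even⇒sign≡0ℙ σ e))

even-∘ : (σ τ : Perm n) → Even σ → Even τ → Even (σ ∘ₚ τ)
even-∘ σ τ eσ eτ = sign≡0ℙ⇒even (σ ∘ₚ τ)
  (trans (sign-∘ σ τ) (cong₂ ℙ._+_ (even⇒sign≡0ℙ σ eσ) (even⇒sign≡0ℙ τ eτ)))

Alt : ℕ → Set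
Alt m = Σ (Perm m) Even

AdjacentPair : ℕ → Set
AdjacentPair m = Σ (Fin m) λ p → Σ (Fin m) λ q → Adjacent p q

module _ {m : ℕ} where

  left right : AdjacentPair m → Fin m
  left  (p , _ , _) = p
  right (_ , q , _) = q

  swap : AdjacentPair m → Perm m
  swap (p , q , _) = transpose p q

  swap-involutive : (a : AdjacentPair m) → swap a ∘ₚ swap a ≈ id
  swap-involutive (p , q , _) = transpose-involutive p q

  ≡left⇒≈swap : (a b : AdjacentPair m) → left a ≡ left b → swap a ≈ swap b
  ≡left⇒≈swap (p , q , adj) (.p , q′ , adj′) refl
    with Fin.toℕ-injective {i = q} {q′} (trans adj (sym adj′))
  ... | refl = λ _ → refl

  doubleSwap : AdjacentPair m → AdjacentPair m → Alt m
  doubleSwap a@(_ , _ , adj) b@(_ , _ , adj′) = swap a ∘ₚ swap b ,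
    sign≡0ℙ⇒even (swap a ∘ₚ swap b) (trans (sign-∘ (swap a) (swap b))
                                          (cong₂ ℙ._+_ (sign-transpose adj) (sign-transpose adj′)))

  predecessor : (a : AdjacentPair m) {k : ℕ} → toℕ (left a) ≡ suc k →
                Σ (AdjacentPair m) λ a′ → toℕ (left a′) ≡ k × right a′ ≡ left a
  predecessor (p , _ , _) {k} p≡1+k = (p′ , p , adj) , Fin.toℕ-fromℕ< k<m , refl
    where
    k<m : k ℕ.< m
    k<m = ℕ.<-trans (ℕ.≤-reflexive (sym p≡1+k)) (Fin.toℕ<n p)
    p′ = Fin.fromℕ< k<m
    adj : Adjacent p′ p
    adj = trans p≡1+k (cong suc (sym (Fin.toℕ-fromℕ< k<m)))

module _ {p q r : Fin n} (p≢q : p ≢ q) (q≢r : q ≢ r) (p≢r : p ≢ r) where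

  private
    c = transpose p q ∘ₚ transpose q r

    c-p : c ⟨$⟩ʳ p ≡ r
    c-p = trans (cong (transpose q r ⟨$⟩ʳ_) (transpose-matchˡ p q)) (transpose-matchˡ q r)

    c-q : c ⟨$⟩ʳ q ≡ p
    c-q = trans (cong (transpose q r ⟨$⟩ʳ_) (transpose-matchʳ p q)) (transpose-mismatch q r p≢q p≢r)

    c-r : c ⟨$⟩ʳ r ≡ q
    c-r = trans (cong (transpose q r ⟨$⟩ʳ_) (transpose-mismatch p q (p≢r ∘ sym) (q≢r ∘ sym)))
                (transpose-matchʳ q r)

    orbit : ∀ {x y z} → c ⟨$⟩ʳ x ≡ y → c ⟨$⟩ʳ y ≡ z → c ⟨$⟩ʳ z ≡ x → c ⟨$⟩ʳ (c ⟨$⟩ʳ (c ⟨$⟩ʳ x)) ≡ x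
    orbit cx≡y cy≡z cz≡x = trans (cong (λ w → c ⟨$⟩ʳ (c ⟨$⟩ʳ w)) cx≡y) (trans (cong (c ⟨$⟩ʳ_) cy≡z) cz≡x)

  threeCycle-cube : c ∘ₚ c ∘ₚ c ≈ id
  threeCycle-cube x with position p q x | position q r x
  ... | at-left           | _                = orbit c-p c-r c-q
  ... | at-right          | _                = orbit c-q c-p c-r
  ... | elsewhere _ x≢q   | at-left          = contradiction refl x≢q
  ... | elsewhere _ _     | at-right         = orbit c-r c-q c-p
  ... | elsewhere x≢p x≢q | elsewhere _ x≢r  = orbit c-x c-x c-x
    where
    c-x : c ⟨$⟩ʳ x ≡ x
    c-x = trans (cong (transpose q r ⟨$⟩ʳ_) (transpose-mismatch p q x≢p x≢q)) (transpose-mismatch q r x≢q x≢r)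

record ParityCharacter (m : ℕ) : Set where
  field
    χ      : Alt m → Parity
    χ-cong : ∀ a b → proj₁ a ≈ proj₁ b → χ a ≡ χ b
    χ-∘    : ∀ a b (e : Even (proj₁ a ∘ₚ proj₁ b)) → χ (proj₁ a ∘ₚ proj₁ b , e) ≡ χ a ℙ.+ χ b

module _ {m : ℕ} (character : ParityCharacter m) where

  open ParityCharacter character

  χ-≈id : (a : Alt m) → proj₁ a ≈ id → χ a ≡ 0ℙ
  χ-≈id a@(σ , e) σ≈id = begin
    χ a                  ≡⟨ χ-cong a (σ ∘ₚ σ , e²) (λ x → sym (cong (σ ⟨$⟩ʳ_) (σ≈id x))) ⟩
    χ (σ ∘ₚ σ , e²)      ≡⟨ χ-∘ a a e² ⟩
    χ a ℙ.+ χ a          ≡⟨ ℙ.p+p≡0ℙ (χ a) ⟩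
    0ℙ                   ∎
    where
    open ≡-Reasoning
    e² = even-∘ σ σ e e

  χ₂ : AdjacentPair m → AdjacentPair m → Parity
  χ₂ a b = χ (doubleSwap a b)

  χ₂-chain : ∀ a b c → χ₂ a b ≡ χ₂ a c ℙ.+ χ₂ c b
  χ₂-chain a b c = trans
    (χ-cong (doubleSwap a b) (ac ∘ₚ cb , e)
            (λ x → cong (swap b ⟨$⟩ʳ_) (sym (swap-involutive c (swap a ⟨$⟩ʳ x)))))
    (χ-∘ (doubleSwap a c) (doubleSwap c b) e)
    where
    ac = proj₁ (doubleSwap a c)
    cb = proj₁ (doubleSwap c b)
    e = even-∘ ac cb (proj₂ (doubleSwap a c)) (proj₂ (doubleSwap c b))

  χ₂-self : ∀ a → χ₂ a a ≡ 0ℙ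
  χ₂-self a = χ-≈id (doubleSwap a a) (swap-involutive a)

  χ₂-sym : ∀ a b → χ₂ b a ≡ χ₂ a b
  χ₂-sym a b = ℙ.+-cancelˡ-≡ (χ₂ a b) (χ₂ b a) (χ₂ a b) (begin
    χ₂ a b ℙ.+ χ₂ b a  ≡⟨ χ₂-chain a a b ⟨
    χ₂ a a             ≡⟨ χ₂-self a ⟩
    0ℙ                 ≡⟨ ℙ.p+p≡0ℙ (χ₂ a b) ⟨
    χ₂ a b ℙ.+ χ₂ a b  ∎)
    where open ≡-Reasoning

  χ₂-consecutive : ∀ a b → right a ≡ left b → χ₂ a b ≡ 0ℙ
  χ₂-consecutive a@(p , q , adj) b@(.q , r , adj′) refl = begin
    χ c                     ≡⟨ ℙ.+-identityʳ (χ c) ⟨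
    χ c ℙ.+ 0ℙ              ≡⟨ cong (χ c ℙ.+_) (ℙ.p+p≡0ℙ (χ c)) ⟨
    χ c ℙ.+ (χ c ℙ.+ χ c)   ≡⟨ cong (χ c ℙ.+_) (χ-∘ c c e²) ⟨
    χ c ℙ.+ χ c²            ≡⟨ χ-∘ c c² e³ ⟨
    χ (γ ∘ₚ γ ∘ₚ γ , e³)    ≡⟨ χ-≈id (γ ∘ₚ γ ∘ₚ γ , e³) (threeCycle-cube p≢q q≢r p≢r) ⟩
    0ℙ                      ∎
    where
    open ≡-Reasoning
    c = doubleSwap a b
    γ = proj₁ c
    e² = even-∘ γ γ (proj₂ c) (proj₂ c)
    c² = (γ ∘ₚ γ , e²)
    e³ = even-∘ γ (γ ∘ₚ γ) (proj₂ c) e²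
    p<q = adjacent⇒< adj
    q<r = adjacent⇒< adj′
    p≢q = Fin.<⇒≢ p<q
    q≢r = Fin.<⇒≢ q<r
    p≢r = Fin.<⇒≢ (Fin.<-trans p<q q<r)

  χ₂-trivial-from-first : ∀ a b → toℕ (left a) ≡ 0 → χ₂ a b ≡ 0ℙ
  χ₂-trivial-from-first a b a₀ = go (toℕ (left b)) b refl
    where
    go : ∀ k b → toℕ (left b) ≡ k → χ₂ a b ≡ 0ℙ
    go zero    b b₀ = trans
      (χ-cong (doubleSwap a b) (doubleSwap a a)
              (λ x → ≡left⇒≈swap b a (Fin.toℕ-injective (trans b₀ (sym a₀))) (swap a ⟨$⟩ʳ x)))
      (χ₂-self a)
    go (suc k) b b≡1+k with predecessor b b≡1+k
    ... | b′ , b′≡k , b′→b =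
      trans (χ₂-chain a b b′) (cong₂ ℙ._+_ (go k b′ b′≡k) (χ₂-consecutive b′ b b′→b))

  χ₂-trivial : ∀ a b → χ₂ a b ≡ 0ℙ
  χ₂-trivial a b = go (toℕ (left a)) a refl
    where
    go : ∀ k a → toℕ (left a) ≡ k → χ₂ a b ≡ 0ℙ
    go zero    a a₀ = χ₂-trivial-from-first a b a₀
    go (suc k) a a≡1+k with predecessor a a≡1+k
    ... | a′ , a′≡k , a′→a =
      trans (χ₂-chain a b a′) (cong₂ ℙ._+_ (trans (χ₂-sym a′ a) (χ₂-consecutive a′ a a′→a)) (go k a′ a′≡k))

  -- Since an adjacent transposition changes the sign, the induction along adjacent
  -- descents tracks χ on σ when σ is even and on swap a ∘ σ when σ is odd.
  Vanishes : Perm m → Set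
  Vanishes σ = (∀ e → χ (σ , e) ≡ 0ℙ) × (∀ a e → χ (swap a ∘ₚ σ , e) ≡ 0ℙ)

  vanishes-≈id : ∀ σ → σ ≈ id → Vanishes σ
  vanishes-≈id σ σ≈id = (λ e → χ-≈id (σ , e) σ≈id) , λ a e → contradiction (begin
    1ℙ                  ≡⟨ cong _⁻¹ (trans (sign-cong {σ = σ} {id} σ≈id) (sign-id {m})) ⟨
    sign σ ⁻¹           ≡⟨ sign-transpose∘ (proj₂ (proj₂ a)) σ ⟨
    sign (swap a ∘ₚ σ)  ≡⟨ even⇒sign≡0ℙ (swap a ∘ₚ σ) e ⟩
    0ℙ                  ∎) λ ()
    where open ≡-Reasoning

  vanishes-step : ∀ σ {p q} → Adjacent p q → σ ⟨$⟩ʳ q < σ ⟨$⟩ʳ p →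
                   Vanishes (transpose p q ∘ₚ σ) → Vanishes σ
  vanishes-step σ {p} {q} adj _ (ih-even , ih-odd) = even-case , odd-case
    where
    t = transpose p q
    σ≈t∘t∘σ : σ ≈ t ∘ₚ t ∘ₚ σ
    σ≈t∘t∘σ x = cong (σ ⟨$⟩ʳ_) (sym (transpose-involutive p q x))

    even-case : ∀ e → χ (σ , e) ≡ 0ℙ
    even-case e = trans (χ-cong (σ , e) (t ∘ₚ t ∘ₚ σ , e′) σ≈t∘t∘σ) (ih-odd (p , q , adj) e′)
      where e′ = even-resp-≈ {σ = σ} {t ∘ₚ t ∘ₚ σ} σ≈t∘t∘σ e

    odd-case : ∀ a e → χ (swap a ∘ₚ σ , e) ≡ 0ℙ
    odd-case a@(_ , _ , adj′) e = begin
      χ (swap a ∘ₚ σ , e)           ≡⟨ χ-cong (swap a ∘ₚ σ , e) (ds ∘ₚ t ∘ₚ σ , e‴) swap-a∘σ≈ds∘t∘σ ⟩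
      χ (ds ∘ₚ t ∘ₚ σ , e‴)         ≡⟨ χ-∘ (doubleSwap a b) (t ∘ₚ σ , e″) e‴ ⟩
      χ₂ a b ℙ.+ χ (t ∘ₚ σ , e″)    ≡⟨ cong₂ ℙ._+_ (χ₂-trivial a b) (ih-even e″) ⟩
      0ℙ                            ∎
      where
      open ≡-Reasoning
      b = (p , q , adj)
      ds = proj₁ (doubleSwap a b)
      swap-a∘σ≈ds∘t∘σ : swap a ∘ₚ σ ≈ ds ∘ₚ t ∘ₚ σ
      swap-a∘σ≈ds∘t∘σ x = cong (σ ⟨$⟩ʳ_) (sym (transpose-involutive p q (swap a ⟨$⟩ʳ x)))
      e″ : Even (t ∘ₚ σ)
      e″ = sign≡0ℙ⇒even (t ∘ₚ σ) (begin
        sign (t ∘ₚ σ)       ≡⟨ sign-transpose∘ adj σ ⟩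
        sign σ ⁻¹           ≡⟨ sign-transpose∘ adj′ σ ⟨
        sign (swap a ∘ₚ σ)  ≡⟨ even⇒sign≡0ℙ (swap a ∘ₚ σ) e ⟩
        0ℙ                  ∎)
      e‴ = even-∘ ds (t ∘ₚ σ) (proj₂ (doubleSwap a b)) e″

  χ-trivial : ∀ a → χ a ≡ 0ℙ
  χ-trivial (σ , e) = proj₁ (adjacentDescent-induction Vanishes vanishes-≈id vanishes-step σ) e

-- Deleting an entry

inversionAt-diagonal : (σ : Perm n) (i : Fin n) → inversionAt σ i i ≡ 0
inversionAt-diagonal σ i = 𝟙-no ((i <? i) ×-dec (σ ⟨$⟩ʳ i <? σ ⟨$⟩ʳ i)) λ (i<i , _) → Fin.<-irrefl refl i<i

degree : Perm n → Fin n → ℕ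
degree {n} σ i = ∑[ j < n ] inversionAt σ i j + ∑[ j < n ] inversionAt σ j i

punchIn-<⇔ : (i : Fin (suc n)) {a b : Fin n} → punchIn i a < punchIn i b ⇔ a < b
punchIn-<⇔ i {a} {b} = mk⇔ (λ ia<ib → ℕ.≰⇒> (ℕ.<⇒≱ ia<ib ∘ Fin.punchIn-mono-≤ i b a))
                          (λ a<b → ℕ.≰⇒> (ℕ.<⇒≱ a<b ∘ Fin.punchIn-cancel-≤ i b a))

module _ (π : Perm (suc n)) (x : Fin (suc n)) where

  private
    τ = remove x π

  remove-<⇔ : ∀ a b → τ ⟨$⟩ʳ a < τ ⟨$⟩ʳ b ⇔ π ⟨$⟩ʳ punchIn x a < π ⟨$⟩ʳ punchIn x b
  remove-<⇔ a b = subst₂ (λ u v → τ ⟨$⟩ʳ a < τ ⟨$⟩ʳ b ⇔ u < v)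
    (sym (punchIn-permute π x a)) (sym (punchIn-permute π x b)) (⇔-sym (punchIn-<⇔ (π ⟨$⟩ʳ x)))

  remove-contains⇒contains : ∀ {k} (ρ : Perm k) → Contains τ ρ → Contains π ρ
  remove-contains⇒contains ρ (f , f-increasing , f-pattern) =
    punchIn x ∘ f ,
    (λ i j i<j → Equivalence.from (punchIn-<⇔ x) (f-increasing i j i<j)) ,
    (λ i j → remove-<⇔ (f i) (f j) ⇔-∘ f-pattern i j)

  inversionAt-punchIn : ∀ a b → inversionAt π (punchIn x a) (punchIn x b) ≡ inversionAt τ a b
  inversionAt-punchIn a b = 𝟙-cong
    ((punchIn x a <? punchIn x b) ×-dec (π ⟨$⟩ʳ punchIn x b <? π ⟨$⟩ʳ punchIn x a))
    ((a <? b) ×-dec (τ ⟨$⟩ʳ b <? τ ⟨$⟩ʳ a))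
    (punchIn-<⇔ x ×-⇔ ⇔-sym (remove-<⇔ b a))

  #inversions-remove : #inversions π ≡ #inversions τ + degree π x
  #inversions-remove = begin
    #inversions π
      ≡⟨ sum-remove {i = x} (λ a → ∑[ b < suc n ] inversionAt π a b) ⟩
    row + ∑[ a < n ] ∑[ b < suc n ] inversionAt π (x↑ a) b
      ≡⟨ cong (row +_) (sum-cong-≗ λ a → sum-remove {i = x} (inversionAt π (x↑ a))) ⟩
    row + ∑[ a < n ] (inversionAt π (x↑ a) x + ∑[ b < n ] inversionAt π (x↑ a) (x↑ b))
      ≡⟨ cong (row +_) (sum-cong-≗ λ a →
           cong (inversionAt π (x↑ a) x +_) (sum-cong-≗ (inversionAt-punchIn a))) ⟩
    row + ∑[ a < n ] (inversionAt π (x↑ a) x + ∑[ b < n ] inversionAt τ a b)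
      ≡⟨ cong (row +_) (∑-distrib-+ (λ a → inversionAt π (x↑ a) x) _) ⟩
    row + (column′ + #inversions τ)
      ≡⟨ ℕ.+-assoc row column′ (#inversions τ) ⟨
    row + column′ + #inversions τ
      ≡⟨ ℕ.+-comm (row + column′) (#inversions τ) ⟩
    #inversions τ + (row + column′)
      ≡⟨ cong (λ c → #inversions τ + (row + c)) column-remove ⟨
    #inversions τ + degree π x ∎
    where
    open ≡-Reasoning
    x↑ = punchIn x
    row = ∑[ b < suc n ] inversionAt π x b
    column′ = ∑[ a < n ] inversionAt π (x↑ a) x
    column-remove : ∑[ a < suc n ] inversionAt π a x ≡ column′
    column-remove = trans (sum-remove {i = x} (λ a → inversionAt π a x))
                          (cong (_+ column′) (inversionAt-diagonal π x))

  degree-punchIn : ∀ y → let y↑ = punchIn x y in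
    degree π y↑ ≡ (inversionAt π y↑ x + inversionAt π x y↑) + degree τ y
  degree-punchIn y = begin
    degree π y↑
      ≡⟨ cong₂ _+_ (sum-remove {i = x} (inversionAt π y↑)) (sum-remove {i = x} (λ a → inversionAt π a y↑)) ⟩
    (inversionAt π y↑ x + ∑[ b < n ] inversionAt π y↑ (punchIn x b)) +
    (inversionAt π x y↑ + ∑[ a < n ] inversionAt π (punchIn x a) y↑)
      ≡⟨ cong₂ (λ r c → (inversionAt π y↑ x + r) + (inversionAt π x y↑ + c))
               (sum-cong-≗ (inversionAt-punchIn y)) (sum-cong-≗ λ a → inversionAt-punchIn a y) ⟩
    (inversionAt π y↑ x + ∑[ b < n ] inversionAt τ y b) +
    (inversionAt π x y↑ + ∑[ a < n ] inversionAt τ a y)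
      ≡⟨ +-interchange (inversionAt π y↑ x) (∑[ b < n ] inversionAt τ y b)
                       (inversionAt π x y↑) (∑[ a < n ] inversionAt τ a y) ⟩
    (inversionAt π y↑ x + inversionAt π x y↑) + degree τ y ∎
    where
    open ≡-Reasoning
    y↑ = punchIn x y

  sign-remove : sign π ≡ sign τ ℙ.+ parity (degree π x)
  sign-remove = trans (cong parity #inversions-remove) (ℙ.+-homo-+ (#inversions τ) (degree π x))

avoidsAll-remove : {T : PatternSet} (π : Perm (suc n)) (x : Fin (suc n)) →
                   AvoidsAll T π → AvoidsAll T (remove x π)
avoidsAll-remove π x avoids k ρ ρ∈T = avoids k ρ ρ∈T ∘ remove-contains⇒contains π x ρ

module _ (T : PatternSet) (n : ℕ) (even : ∀ {k} (σ : Perm k) → n ≤ k → AvoidsAll T σ → sign σ ≡ 0ℙ) where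

  evenAvoiders⇒noInversion : (π : Perm (2 + n)) → AvoidsAll T π →
                             ∀ {p q} → p < q → ¬ (π ⟨$⟩ʳ q < π ⟨$⟩ʳ p)
  evenAvoiders⇒noInversion π avoids {p} {q} p<q descent = contradiction (begin
    0ℙ                                          ≡⟨ even τ (ℕ.n≤1+n n) τ-avoids ⟨
    sign τ                                      ≡⟨ sign-remove τ q′ ⟩
    sign (remove q′ τ) ℙ.+ parity (degree τ q′) ≡⟨ cong (ℙ._+ parity (degree τ q′)) τ-q′-even ⟩
    parity (degree τ q′)                        ≡⟨ ℙ.suc-homo-⁻¹ (degree τ q′) ⟨
    parity (suc (degree τ q′)) ⁻¹               ≡⟨ cong (λ d → parity d ⁻¹) degree-q ⟨
    parity (degree π q) ⁻¹                      ≡⟨ cong _⁻¹ degree-q-even ⟩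
    1ℙ                                          ∎) λ ()
    where
    open ≡-Reasoning
    τ = remove p π
    τ-avoids = avoidsAll-remove π p avoids
    q′ = punchOut (Fin.<⇒≢ p<q)
    q′↦q : punchIn p q′ ≡ q
    q′↦q = Fin.punchIn-punchOut (Fin.<⇒≢ p<q)

    τ-q′-even : sign (remove q′ τ) ≡ 0ℙ
    τ-q′-even = even (remove q′ τ) ℕ.≤-refl (avoidsAll-remove τ q′ τ-avoids)

    degree-q-even : parity (degree π q) ≡ 0ℙ
    degree-q-even = begin
      parity (degree π q)                        ≡⟨ cong (ℙ._+ parity (degree π q)) π-q-even ⟨
      sign (remove q π) ℙ.+ parity (degree π q)  ≡⟨ sign-remove π q ⟨
      sign π                                     ≡⟨ even π (ℕ.m≤n+m n 2) avoids ⟩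
      0ℙ                                         ∎
      where π-q-even = even (remove q π) (ℕ.n≤1+n _) (avoidsAll-remove π q avoids)

    degree-q : degree π q ≡ suc (degree τ q′)
    degree-q = begin
      degree π q
        ≡⟨ cong (degree π) q′↦q ⟨
      degree π (punchIn p q′)
        ≡⟨ degree-punchIn π p q′ ⟩
      (inversionAt π (punchIn p q′) p + inversionAt π p (punchIn p q′)) + degree τ q′
        ≡⟨ cong (λ y → (inversionAt π y p + inversionAt π p y) + degree τ q′) q′↦q ⟩
      (inversionAt π q p + inversionAt π p q) + degree τ q′
        ≡⟨ cong₂ (λ i j → (i + j) + degree τ q′)
             (𝟙-no ((q <? p) ×-dec (π ⟨$⟩ʳ p <? π ⟨$⟩ʳ q)) λ (q<p , _) → Fin.<-asym p<q q<p)
             (𝟙-yes ((p <? q) ×-dec (π ⟨$⟩ʳ q <? π ⟨$⟩ʳ p)) (p<q , descent)) ⟩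
      suc (degree τ q′) ∎

  evenAvoiders⇒≈id : (π : Perm (2 + n)) → AvoidsAll T π → π ≈ id
  evenAvoiders⇒≈id π avoids with adjacentDescent⊎≈id π
  ... | inj₁ (_ , _ , adj , descent) =
    contradiction descent (evenAvoiders⇒noInversion π avoids (adjacent⇒< adj))
  ... | inj₂ π≈id = π≈id

-- Subgroups of Sₙ isomorphic to an alternating group

InGen-≈id : {X : Perm n → Set} → (∀ σ → X σ → σ ≈ id) → ∀ σ → InGen X σ → σ ≈ id
InGen-≈id X≈id σ (gen x)               = X≈id σ x
InGen-≈id X≈id _ one                   = λ _ → refl
InGen-≈id X≈id _ (mul {σ} {τ} gσ gτ) i =
  trans (cong (τ ⟨$⟩ʳ_) (InGen-≈id X≈id σ gσ i)) (InGen-≈id X≈id τ gτ i)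
InGen-≈id X≈id _ (inv {σ} gσ) i        = trans (cong (σ ⟨$⟩ˡ_) (sym (InGen-≈id X≈id σ gσ i))) (inverseˡ σ)
InGen-≈id X≈id _ (resp {σ} σ≈τ gσ) i   = trans (sym (σ≈τ i)) (InGen-≈id X≈id σ gσ i)

module _ {m : ℕ} {H : Perm n → Set} (iso : SubgroupIso H (Even {m})) where

  open SubgroupIso iso

  ≅Alt-trivial : (∀ σ → H σ → σ ≈ id) → ∀ (a : Alt m) → proj₁ a ≈ id
  ≅Alt-trivial H≈id a i = begin
    proj₁ a ⟨$⟩ʳ i              ≡⟨ to-from a i ⟨
    proj₁ (to (from a)) ⟨$⟩ʳ i  ≡⟨ to-cong (from a) (from ε) from-a≈from-ε i ⟩
    proj₁ (to (from ε)) ⟨$⟩ʳ i  ≡⟨ to-from ε i ⟩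
    i                           ∎
    where
    open ≡-Reasoning
    ε : Alt m
    ε = id , sign≡0ℙ⇒even (id {m}) (sign-id {m})
    from-≈id : ∀ b → proj₁ (from b) ≈ id
    from-≈id b = H≈id (proj₁ (from b)) (proj₂ (from b))
    from-a≈from-ε : proj₁ (from a) ≈ proj₁ (from ε)
    from-a≈from-ε j = trans (from-≈id a j) (sym (from-≈id ε j))

  module _ (H-∘ : ∀ {σ τ} → H σ → H τ → H (σ ∘ₚ τ)) where

    from-∘ : ∀ a b (e : Even (proj₁ a ∘ₚ proj₁ b)) →
             proj₁ (from (proj₁ a ∘ₚ proj₁ b , e)) ≈ proj₁ (from a) ∘ₚ proj₁ (from b)
    from-∘ a b e i = begin
      proj₁ (from (proj₁ a ∘ₚ proj₁ b , e)) ⟨$⟩ʳ i   ≡⟨ from-cong (to ab) (proj₁ a ∘ₚ proj₁ b , e) to-ab i ⟨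
      proj₁ (from (to ab)) ⟨$⟩ʳ i                     ≡⟨ from-to ab i ⟩
      proj₁ ab ⟨$⟩ʳ i                                 ∎
      where
      open ≡-Reasoning
      ab : Σ (Perm n) H
      ab = proj₁ (from a) ∘ₚ proj₁ (from b) , H-∘ (proj₂ (from a)) (proj₂ (from b))
      to-ab : proj₁ (to ab) ≈ proj₁ a ∘ₚ proj₁ b
      to-ab j = trans (to-hom (from a) (from b) (proj₂ ab) j)
                      (trans (cong (proj₁ (to (from b)) ⟨$⟩ʳ_) (to-from a j)) (to-from b _))

    sign∘from : ParityCharacter m
    sign∘from = record
      { χ      = sign ∘ proj₁ ∘ from
      ; χ-cong = λ a b a≈b → sign-cong {σ = proj₁ (from a)} {proj₁ (from b)} (from-cong a b a≈b)
      ; χ-∘    = λ a b e → trans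
          (sign-cong {σ = proj₁ (from (proj₁ a ∘ₚ proj₁ b , e))} {proj₁ (from a) ∘ₚ proj₁ (from b)}
                     (from-∘ a b e))
          (sign-∘ (proj₁ (from a)) (proj₁ (from b)))
      }

    ≅Alt⇒sign≡0ℙ : ∀ {σ} → H σ → sign σ ≡ 0ℙ
    ≅Alt⇒sign≡0ℙ {σ} h = trans (sign-cong {σ = σ} {proj₁ (from (to (σ , h)))} (sym ∘ from-to (σ , h)))
                               (χ-trivial sign∘from (to (σ , h)))

Alt-nontrivial : ∀ {m} → 2 ℕ.< m → ¬ (∀ (a : Alt m) → proj₁ a ≈ id)
Alt-nontrivial (s≤s (s≤s (s≤s _))) trivial =
  contradiction (trivial (doubleSwap (zero , suc zero , refl) (suc zero , suc (suc zero) , refl)) zero) λ ()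

theorem5p5 : (T : PatternSet) (m : ℕ) → 1 ≤ m →
             (∃ λ n₀ → ∀ n → n₀ ≤ n → GenIsoAlt T n m) →
             m ≤ 2
theorem5p5 T m _ (n₀ , ≅Alt) = ℕ.≮⇒≥ λ 2<m →
  Alt-nontrivial 2<m (≅Alt-trivial (≅Alt (2 + n₀) (ℕ.m≤n+m n₀ 2)) (InGen-≈id avoiders≈id))
  where
  evenAvoiders : ∀ {k} (σ : Perm k) → n₀ ≤ k → AvoidsAll T σ → sign σ ≡ 0ℙ
  evenAvoiders σ n₀≤k avoids = ≅Alt⇒sign≡0ℙ (≅Alt _ n₀≤k) mul {σ} (gen avoids)

  avoiders≈id : ∀ (π : Perm (2 + n₀)) → AvoidsAll T π → π ≈ id
  avoiders≈id = evenAvoiders⇒≈id T n₀ evenAvoiders
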